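{- For every closed System T term $t$ of type $(\iota\Rightarrow\iota)\Rightarrow\iota$ and every $\alpha:\mathbb{N}\to\mathbb{N}$, we have $[\![\mathsf{maxQ}^T\,(\mathsf{dialogueTree}_\iota(t))]\!]\,\alpha=\mathsf{maxQ}\,(\mathsf{dialogueTree}(t))\,\alpha$.
   Context: Metatheory: constructive Martin-Löf type theory without function extensionality; $\mathsf{Natrec}\,f\,x\,0=x$, $\mathsf{Natrec}\,f\,x\,(n+1)=f\,n\,(\mathsf{Natrec}\,f\,x\,n)$. System T: types from base $\iota$ and $\sigma\Rightarrow\tau$; terms: variables, $\mathsf{zero}$, $\mathsf{succ}\,t$, $\mathsf{rec}_\sigma\,t\,p\,q:\sigma$ ($t:\iota\Rightarrow\sigma\Rightarrow\sigma$, $p:\sigma$, $q:\iota$), $\lambda$, application. Set interpretation $[\![\iota]\!]=\mathbb{N}$, $[\![\sigma\Rightarrow\tau]\!]=[\![\sigma]\!]\to[\![\tau]\!]$, standard on terms ($\mathsf{rec}$ via $\mathsf{Natrec}$). Dialogue trees $\mathcal{D}_{\mathbb N}\mathbb{N}$: inductive, constructors $\eta\,n$, $\beta\,\varphi\,i$. Kleisli $f^\sharp(\eta\,x)=f\,x$, $f^\sharp(\beta\,\varphi\,i)=\beta(\lambda o.f^\sharp(\varphi\,o))\,i$; $\mathsf{map}\,f=(\eta\circ f)^\sharp$. $\mathcal{B}[\![\iota]\!]=\mathcal{D}_{\mathbb N}\mathbb{N}$, arrows to function types; $\mathsf{ext}_\iota f\,d=f^\sharp d$, $\mathsf{ext}_{\sigma_1\Rightarrow\sigma_2}f\,d\,s=\mathsf{ext}_{\sigma_2}(\lambda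 x.f\,x\,s)\,d$; $\mathcal{B}[\![\mathsf{zero}]\!]\gamma=\eta\,0$, $\mathcal{B}[\![\mathsf{succ}\,t]\!]\gamma=\mathsf{map}(\lambda n.n+1)(\mathcal{B}[\![t]\!]\gamma)$, $\mathcal{B}[\![\mathsf{rec}_\sigma t_1t_2t_3]\!]\gamma=\mathsf{ext}_\sigma(\mathsf{Natrec}(\mathcal{B}[\![t_1]\!]\gamma\circ\eta)(\mathcal{B}[\![t_2]\!]\gamma))(\mathcal{B}[\![t_3]\!]\gamma)$, variables/$\lambda$/application standard. $\mathsf{generic}:=(\lambda i.\beta\,\eta\,i)^\sharp$; $\mathsf{dialogueTree}(t):=\mathcal{B}[\![t]\!]\,\mathsf{generic}$. $\mathsf{maxQ}(\eta\,n)\,\alpha=0$, $\mathsf{maxQ}(\beta\,\varphi\,n)\,\alpha=\max(n,\mathsf{maxQ}(\varphi(\alpha\,n))\,\alpha)$. Internal: $\mathsf{ChD}_A(\sigma):=(\sigma\Rightarrow A)\Rightarrow((\iota\Rightarrow A)\Rightarrow\iota\Rightarrow A)\Rightarrow A$; $\eta_A:=\lambda z\,e\,b.\,e\,z$; $\beta_A:=\lambda\varphi\,x\,e\,b.\,b(\lambda y.\varphi\,y\,e\,b)\,x$; $K_A:=\lambda f\,d\,e'\,b'.\,d(\lambda x.f\,x\,e'\,b')\,b'$; $\mathsf{map}_A:=\lambda f.K_A(\lambda x.\eta_A(f\,x))$. $\lceil\iota\rceil_A=\mathsf{ChD}_A(\iota)$, arrows homomorphically. $\mathsf{ext}^T_{\iota,A}:=K_A$,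 $\mathsf{ext}^T_{\sigma_1\Rightarrow\sigma_2,A}:=\lambda f\,d\,s.\mathsf{ext}^T_{\sigma_2,A}(\lambda x.f\,x\,s)\,d$. $\lceil x\rceil_A=x$, $\lceil\mathsf{zero}\rceil_A=\eta_A\,\mathsf{zero}$, $\lceil\mathsf{succ}\,t\rceil_A=\mathsf{map}_A(\lambda n.\mathsf{succ}\,n)\lceil t\rceil_A$, $\lceil\mathsf{rec}_\sigma t_1t_2t_3\rceil_A=\mathsf{ext}^T_{\sigma,A}(\lambda n.\mathsf{rec}_{\lceil\sigma\rceil_A}(\lambda x.\lceil t_1\rceil_A(\eta_A x))\lceil t_2\rceil_A\,n)\lceil t_3\rceil_A$, $\lambda$/application homomorphically. $\mathsf{generic}_A:=K_A(\lambda i.\beta_A\,\eta_A\,i)$; $\mathsf{dialogueTree}_A(t):=\lceil t\rceil_A\,\mathsf{generic}_A$. Fix closed $\mathsf{max}^T:\iota\Rightarrow\iota\Rightarrow\iota$ with $[\![\mathsf{max}^T]\!]\,a\,b=\max(a,b)$; $\mathsf{maxQ}^T:=\lambda d\,\alpha.\,d\,(\lambda w.\mathsf{zero})\,(\lambda g\,x.\,\mathsf{max}^T\,x\,(g\,(\alpha\,x)))$. -}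

module Defs where

open import Data.Nat using (ℕ; zero; suc; _⊔_)

infixr 7 _⇒_
data Ty : Set where
  ι   : Ty
  _⇒_ : Ty → Ty → Ty

infixl 5 _,_
data Ctx : Set where
  ε   : Ctx
  _,_ : Ctx → Ty → Ctx

infix 4 _∋_
data _∋_ : Ctx → Ty → Set where
  here  : ∀ {Γ σ} → Γ , σ ∋ σ
  there : ∀ {Γ σ τ} → Γ ∋ σ → Γ , τ ∋ σ

infixl 9 _·_
data Tm (Γ : Ctx) : Ty → Set where
  var  : ∀ {σ} → Γ ∋ σ → Tm Γ σ
  Zero : Tm Γ ι
  Succ : Tm Γ ι → Tm Γ ι
  Rec  : ∀ {σ} → Tm Γ (ι ⇒ σ ⇒ σ) → Tm Γ σ → Tm Γ ι → Tm Γ σ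
  Lam  : ∀ {σ τ} → Tm (Γ , σ) τ → Tm Γ (σ ⇒ τ)
  _·_  : ∀ {σ τ} → Tm Γ (σ ⇒ τ) → Tm Γ σ → Tm Γ τ

Ren : Ctx → Ctx → Set
Ren Γ Δ = ∀ {σ} → Γ ∋ σ → Δ ∋ σ

liftR : ∀ {Γ Δ τ} → Ren Γ Δ → Ren (Γ , τ) (Δ , τ)
liftR ρ here      = here
liftR ρ (there x) = there (ρ x)

rename : ∀ {Γ Δ σ} → Ren Γ Δ → Tm Γ σ → Tm Δ σ
rename ρ (var x)       = var (ρ x)
rename ρ Zero          = Zero
rename ρ (Succ t)      = Succ (rename ρ t)
rename ρ (Rec t p q)   = Rec (rename ρ t) (rename ρ p) (rename ρ q)
rename ρ (Lam t)       = Lam (rename (liftR ρ) t)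
rename ρ (t · u)       = rename ρ t · rename ρ u

wk : ∀ {Γ σ τ} → Tm Γ σ → Tm (Γ , τ) σ
wk = rename there

wk0 : ∀ {Γ σ} → Tm ε σ → Tm Γ σ
wk0 = rename (λ ())

v0 : ∀ {Γ σ} → Tm (Γ , σ) σ
v0 = var here
v1 : ∀ {Γ σ τ₁} → Tm (Γ , σ , τ₁) σ
v1 = var (there here)
v2 : ∀ {Γ σ τ₁ τ₂} → Tm (Γ , σ , τ₁ , τ₂) σ
v2 = var (there (there here))
v3 : ∀ {Γ σ τ₁ τ₂ τ₃} → Tm (Γ , σ , τ₁ , τ₂ , τ₃) σ
v3 = var (there (there (there here)))
v4 : ∀ {Γ σ τ₁ τ₂ τ₃ τ₄} → Tm (Γ , σ , τ₁ , τ₂ , τ₃ , τ₄) σ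
v4 = var (there (there (there (there here))))

Natrec : {A : Set} → (ℕ → A → A) → A → ℕ → A
Natrec f x zero    = x
Natrec f x (suc n) = f n (Natrec f x n)

⟦_⟧ty : Ty → Set
⟦ ι ⟧ty     = ℕ
⟦ σ ⇒ τ ⟧ty = ⟦ σ ⟧ty → ⟦ τ ⟧ty

Env : Ctx → Set
Env Γ = ∀ {σ} → Γ ∋ σ → ⟦ σ ⟧ty

emptyEnv : Env ε
emptyEnv ()

_∷ₑ_ : ∀ {Γ σ} → Env Γ → ⟦ σ ⟧ty → Env (Γ , σ)
(γ ∷ₑ a) here      = a
(γ ∷ₑ a) (there x) = γ x

⟦_⟧ : ∀ {Γ σ} → Tm Γ σ → Env Γ → ⟦ σ ⟧ty
⟦ var x ⟧ γ     = γ x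
⟦ Zero ⟧ γ      = zero
⟦ Succ t ⟧ γ    = suc (⟦ t ⟧ γ)
⟦ Rec t p q ⟧ γ = Natrec (⟦ t ⟧ γ) (⟦ p ⟧ γ) (⟦ q ⟧ γ)
⟦ Lam t ⟧ γ     = λ a → ⟦ t ⟧ (γ ∷ₑ a)
⟦ t · u ⟧ γ     = ⟦ t ⟧ γ (⟦ u ⟧ γ)

data D : Set where
  η : ℕ → D
  β : (ℕ → D) → ℕ → D

_♯ : (ℕ → D) → D → D
(f ♯) (η x)   = f x
(f ♯) (β φ i) = β (λ o → (f ♯) (φ o)) i

mapD : (ℕ → ℕ) → D → D
mapD f = (λ x → η (f x)) ♯

B⟦_⟧ty : Ty → Set
B⟦ ι ⟧ty     = D
B⟦ σ ⇒ τ ⟧ty = B⟦ σ ⟧ty → B⟦ τ ⟧ty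

extB : (σ : Ty) → (ℕ → B⟦ σ ⟧ty) → D → B⟦ σ ⟧ty
extB ι         f d   = (f ♯) d
extB (σ₁ ⇒ σ₂) f d s = extB σ₂ (λ x → f x s) d

BEnv : Ctx → Set
BEnv Γ = ∀ {σ} → Γ ∋ σ → B⟦ σ ⟧ty

emptyBEnv : BEnv ε
emptyBEnv ()

_∷ᵇ_ : ∀ {Γ σ} → BEnv Γ → B⟦ σ ⟧ty → BEnv (Γ , σ)
(γ ∷ᵇ a) here      = a
(γ ∷ᵇ a) (there x) = γ x

B⟦_⟧ : ∀ {Γ σ} → Tm Γ σ → BEnv Γ → B⟦ σ ⟧ty
B⟦ var x ⟧ γ             = γ x
B⟦ Zero ⟧ γ              = η 0
B⟦ Succ t ⟧ γ            = mapD (λ n → suc n) (B⟦ t ⟧ γ)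
B⟦ Rec {σ = σ} t p q ⟧ γ =
  extB σ (Natrec (λ n → B⟦ t ⟧ γ (η n)) (B⟦ p ⟧ γ)) (B⟦ q ⟧ γ)
B⟦ Lam t ⟧ γ             = λ a → B⟦ t ⟧ (γ ∷ᵇ a)
B⟦ t · u ⟧ γ             = B⟦ t ⟧ γ (B⟦ u ⟧ γ)

generic : D → D
generic = (λ i → β η i) ♯

dialogueTree : Tm ε ((ι ⇒ ι) ⇒ ι) → D
dialogueTree t = B⟦ t ⟧ emptyBEnv generic

maxQ : D → (ℕ → ℕ) → ℕ
maxQ (η n)   α = 0
maxQ (β φ n) α = n ⊔ maxQ (φ (α n)) α

-- Internal (Church-encoded) dialogue translation, parametrised by A

ChD : Ty → Ty → Ty
ChD A σ = (σ ⇒ A) ⇒ ((ι ⇒ A) ⇒ ι ⇒ A) ⇒ A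

-- η_A = λ z e b. e z
ηA : (A : Ty) → Tm ε (ι ⇒ ChD A ι)
ηA A = Lam (Lam (Lam (v1 · v2)))

-- β_A = λ φ x e b. b (λ y. φ y e b) x
βA : (A : Ty) → Tm ε ((ι ⇒ ChD A ι) ⇒ ι ⇒ ChD A ι)
βA A = Lam (Lam (Lam (Lam (v0 · Lam (v4 · v0 · v2 · v1) · v2))))

-- K_A = λ f d e' b'. d (λ x. f x e' b') b'
KA : (A : Ty) → Tm ε ((ι ⇒ ChD A ι) ⇒ ChD A ι ⇒ ChD A ι)
KA A = Lam (Lam (Lam (Lam (v2 · Lam (v4 · v0 · v2 · v1) · v0))))

mapA : (A : Ty) → Tm ε ((ι ⇒ ι) ⇒ ChD A ι ⇒ ChD A ι)
mapA A = Lam (wk0 (KA A) · Lam (wk0 (ηA A) · (v1 · v0)))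

⌈_⌉ty : Ty → Ty → Ty
⌈ ι ⌉ty     A = ChD A ι
⌈ σ ⇒ τ ⌉ty A = ⌈ σ ⌉ty A ⇒ ⌈ τ ⌉ty A

⌈_⌉ctx : Ctx → Ty → Ctx
⌈ ε ⌉ctx     A = ε
⌈ Γ , σ ⌉ctx A = ⌈ Γ ⌉ctx A , ⌈ σ ⌉ty A

⌈_⌉var : ∀ {Γ σ} → Γ ∋ σ → (A : Ty) → ⌈ Γ ⌉ctx A ∋ ⌈ σ ⌉ty A
⌈ here ⌉var    A = here
⌈ there x ⌉var A = there (⌈ x ⌉var A)

extT : (σ A : Ty) → Tm ε ((ι ⇒ ⌈ σ ⌉ty A) ⇒ ChD A ι ⇒ ⌈ σ ⌉ty A)
extT ι         A = KA A
extT (σ₁ ⇒ σ₂) A = Lam (Lam (Lam (wk0 (extT σ₂ A) · Lam (v3 · v0 · v1) · v1)))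

⌈_⌉ : ∀ {Γ σ} → Tm Γ σ → (A : Ty) → Tm (⌈ Γ ⌉ctx A) (⌈ σ ⌉ty A)
⌈ var x ⌉ A             = var (⌈ x ⌉var A)
⌈ Zero ⌉ A              = wk0 (ηA A) · Zero
⌈ Succ t ⌉ A            = wk0 (mapA A) · Lam (Succ v0) · ⌈ t ⌉ A
⌈ Rec {σ = σ} t p q ⌉ A =
  wk0 (extT σ A)
    · Lam (Rec (Lam (wk (wk (⌈ t ⌉ A)) · (wk0 (ηA A) · v0))) (wk (⌈ p ⌉ A)) v0)
    · ⌈ q ⌉ A
⌈ Lam t ⌉ A             = Lam (⌈ t ⌉ A)
⌈ t · u ⌉ A             = ⌈ t ⌉ A · ⌈ u ⌉ A

genericA : (A : Ty) → Tm ε (ChD A ι ⇒ ChD A ι)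
genericA A = KA A · Lam (wk0 (βA A) · wk0 (ηA A) · v0)

dialogueTreeA : (A : Ty) → Tm ε ((ι ⇒ ι) ⇒ ι) → Tm ε (ChD A ι)
dialogueTreeA A t = ⌈ t ⌉ A · genericA A

-- maxQ^T = λ d α. d (λ w. zero) (λ g x. max^T x (g (α x))), for a given max^T
maxQT : Tm ε (ι ⇒ ι ⇒ ι) → Tm ε (ChD ι ι ⇒ (ι ⇒ ι) ⇒ ι)
maxQT maxT = Lam (Lam (v1 · Lam Zero · Lam (Lam (wk0 maxT · v0 · (v1 · (v2 · v0))))))

module Submission where

open import Defs
open import Data.Nat using (ℕ; zero; suc; _⊔_)
open import Function using (_∘_; id)
open import Relation.Binary.PropositionalEquality using (_≡_; _≗_; refl; sym; trans; cong; cong₂; subst)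

-- A Church-encoded tree c : ⟦ ChD A ι ⟧ty represents a dialogue tree d when c e b is the
-- fold of d with leaf case e and node case b.  Without function extensionality this only
-- holds for node cases b that respect pointwise equality, so the relation quantifies over
-- those.  Lifted to all types as a logical relation, it relates the internal translation of
-- every term to its external dialogue interpretation.  maxQ^T applies the tree to the leaf
-- case λ w → 0 and the node case λ g x → max x (g (α x)), whose fold is maxQ.

liftR-cong : ∀ {Γ Δ τ} {ρ ρ' : Ren Γ Δ} → (∀ {σ} (x : Γ ∋ σ) → ρ x ≡ ρ' x)
           → ∀ {σ} (x : Γ , τ ∋ σ) → liftR ρ x ≡ liftR ρ' x
liftR-cong ρ≗ρ' here      = refl
liftR-cong ρ≗ρ' (there x) = cong there (ρ≗ρ' x)

rename-cong : ∀ {Γ Δ σ} {ρ ρ' : Ren Γ Δ} → (∀ {τ} (x : Γ ∋ τ) → ρ x ≡ ρ' x)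
            → (t : Tm Γ σ) → rename ρ t ≡ rename ρ' t
rename-cong ρ≗ρ' (var x)     = cong var (ρ≗ρ' x)
rename-cong ρ≗ρ' Zero        = refl
rename-cong ρ≗ρ' (Succ t)    = cong Succ (rename-cong ρ≗ρ' t)
rename-cong ρ≗ρ' (Rec t p q)
  rewrite rename-cong ρ≗ρ' t | rename-cong ρ≗ρ' p | rename-cong ρ≗ρ' q = refl
rename-cong ρ≗ρ' (Lam t)     = cong Lam (rename-cong (liftR-cong ρ≗ρ') t)
rename-cong ρ≗ρ' (t · u)     = cong₂ _·_ (rename-cong ρ≗ρ' t) (rename-cong ρ≗ρ' u)

liftR-∘ : ∀ {Γ Δ Θ τ} (ρ : Ren Δ Θ) (ρ' : Ren Γ Δ)
        → ∀ {σ} (x : Γ , τ ∋ σ) → liftR ρ (liftR ρ' x) ≡ liftR (ρ ∘ ρ') x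
liftR-∘ ρ ρ' here      = refl
liftR-∘ ρ ρ' (there x) = refl

rename-∘ : ∀ {Γ Δ Θ σ} (ρ : Ren Δ Θ) (ρ' : Ren Γ Δ) (t : Tm Γ σ)
         → rename ρ (rename ρ' t) ≡ rename (ρ ∘ ρ') t
rename-∘ ρ ρ' (var x)     = refl
rename-∘ ρ ρ' Zero        = refl
rename-∘ ρ ρ' (Succ t)    = cong Succ (rename-∘ ρ ρ' t)
rename-∘ ρ ρ' (Rec t p q)
  rewrite rename-∘ ρ ρ' t | rename-∘ ρ ρ' p | rename-∘ ρ ρ' q = refl
rename-∘ ρ ρ' (Lam t)     =
  cong Lam (trans (rename-∘ (liftR ρ) (liftR ρ') t) (rename-cong (liftR-∘ ρ ρ') t))
rename-∘ ρ ρ' (t · u)     = cong₂ _·_ (rename-∘ ρ ρ' t) (rename-∘ ρ ρ' u)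

liftR-id : ∀ {Γ τ σ} (x : Γ , τ ∋ σ) → liftR id x ≡ x
liftR-id here      = refl
liftR-id (there x) = refl

rename-id : ∀ {Γ σ} (t : Tm Γ σ) → rename id t ≡ t
rename-id (var x)     = refl
rename-id Zero        = refl
rename-id (Succ t)    = cong Succ (rename-id t)
rename-id (Rec t p q) rewrite rename-id t | rename-id p | rename-id q = refl
rename-id (Lam t)     = cong Lam (trans (rename-cong liftR-id t) (rename-id t))
rename-id (t · u)     = cong₂ _·_ (rename-id t) (rename-id u)

rename-wk0 : ∀ {Δ Θ σ} (ρ : Ren Δ Θ) (s : Tm ε σ) → rename ρ (wk0 s) ≡ wk0 s
rename-wk0 ρ s = trans (rename-∘ ρ (λ ()) s) (rename-cong (λ ()) s)

ExtEq : (σ : Ty) → ⟦ σ ⟧ty → ⟦ σ ⟧ty → Set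
ExtEq ι       a b = a ≡ b
ExtEq (σ ⇒ τ) f g = ∀ {x y} → ExtEq σ x y → ExtEq τ (f x) (g y)

Natrec-cong : ∀ σ {f g : ⟦ ι ⇒ σ ⇒ σ ⟧ty} {x y} → ExtEq (ι ⇒ σ ⇒ σ) f g → ExtEq σ x y
            → ∀ n → ExtEq σ (Natrec f x n) (Natrec g y n)
Natrec-cong σ f≈g x≈y zero    = x≈y
Natrec-cong σ f≈g x≈y (suc n) = f≈g {n} refl (Natrec-cong σ f≈g x≈y n)

⟦rename⟧ : ∀ {Γ Δ σ} (t : Tm Γ σ) (ρ : Ren Γ Δ) (γ : Env Δ) (γ' : Env Γ)
         → (∀ {τ} (x : Γ ∋ τ) → ExtEq τ (γ (ρ x)) (γ' x))
         → ExtEq σ (⟦ rename ρ t ⟧ γ) (⟦ t ⟧ γ')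
⟦rename⟧ (var x)             ρ γ γ' γ≈γ' = γ≈γ' x
⟦rename⟧ Zero                ρ γ γ' γ≈γ' = refl
⟦rename⟧ (Succ t)            ρ γ γ' γ≈γ' = cong suc (⟦rename⟧ t ρ γ γ' γ≈γ')
⟦rename⟧ (Rec {σ = σ} t p q) ρ γ γ' γ≈γ'
  rewrite ⟦rename⟧ q ρ γ γ' γ≈γ' =
  Natrec-cong σ (⟦rename⟧ t ρ γ γ' γ≈γ') (⟦rename⟧ p ρ γ γ' γ≈γ') (⟦ q ⟧ γ')
⟦rename⟧ (Lam {σ = σ} t)     ρ γ γ' γ≈γ' {a} {a'} a≈a' =
  ⟦rename⟧ t (liftR ρ) (γ ∷ₑ a) (γ' ∷ₑ a') extended
  where
  extended : ∀ {τ} (x : _ , σ ∋ τ) → ExtEq τ ((γ ∷ₑ a) (liftR ρ x)) ((γ' ∷ₑ a') x)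
  extended here      = a≈a'
  extended (there x) = γ≈γ' x
⟦rename⟧ (t · u)             ρ γ γ' γ≈γ' = ⟦rename⟧ t ρ γ γ' γ≈γ' (⟦rename⟧ u ρ γ γ' γ≈γ')

⟦wk0⟧ : ∀ {Γ σ} (s : Tm ε σ) (γ : Env Γ) → ExtEq σ (⟦ wk0 s ⟧ γ) (⟦ s ⟧ emptyEnv)
⟦wk0⟧ s γ = ⟦rename⟧ s (λ ()) γ emptyEnv (λ ())

foldD : {X : Set} → D → (ℕ → X) → ((ℕ → X) → ℕ → X) → X
foldD (η n)   e b = e n
foldD (β φ i) e b = b (λ o → foldD (φ o) e b) i

Extensional : {X : Set} → ((ℕ → X) → ℕ → X) → Set
Extensional b = ∀ {g g'} → g ≗ g' → ∀ i → b g i ≡ b g' i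

foldD-♯ : {X : Set} (e : ℕ → X) {b : (ℕ → X) → ℕ → X} → Extensional b
        → {f : ℕ → X} {f' : ℕ → D} → (∀ n → f n ≡ foldD (f' n) e b)
        → ∀ d → foldD d f b ≡ foldD ((f' ♯) d) e b
foldD-♯ e b-ext f≡ (η n)   = f≡ n
foldD-♯ e b-ext f≡ (β φ i) = b-ext (λ o → foldD-♯ e b-ext f≡ (φ o)) i

module _ (α : ℕ → ℕ) {b : (ℕ → ℕ) → ℕ → ℕ} (b≗ : ∀ g i → b g i ≡ i ⊔ g (α i)) where

  maxQ-node-extensional : Extensional b
  maxQ-node-extensional {g} {g'} g≗g' i =
    trans (b≗ g i) (trans (cong (i ⊔_) (g≗g' (α i))) (sym (b≗ g' i)))

  foldD-maxQ : ∀ d → foldD d (λ _ → 0) b ≡ maxQ d α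
  foldD-maxQ (η n)   = refl
  foldD-maxQ (β φ i) = trans (b≗ _ i) (cong (i ⊔_) (foldD-maxQ (φ (α i))))

module Representation (A : Ty) where

  Represents : (σ : Ty) → ⟦ ⌈ σ ⌉ty A ⟧ty → B⟦ σ ⟧ty → Set
  Represents ι       c d = ∀ e {b} → Extensional b → c e b ≡ foldD d e b
  Represents (σ ⇒ τ) f g = ∀ {x y} → Represents σ x y → Represents τ (f x) (g y)

  K : (ℕ → ⟦ ChD A ι ⟧ty) → ⟦ ChD A ι ⟧ty → ⟦ ChD A ι ⟧ty
  K f c e b = c (λ x → f x e b) b

  represents-η : ∀ n → Represents ι (λ e b → e n) (η n)
  represents-η n e b-ext = refl

  represents-K : ∀ {f} f' → (∀ n → Represents ι (f n) (f' n))
               → ∀ {c} d → Represents ι c d → Represents ι (K f c) ((f' ♯) d)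
  represents-K f' f≈f' d c≈d e b-ext =
    trans (c≈d _ b-ext) (foldD-♯ e b-ext {f' = f'} (λ n → f≈f' n e b-ext) d)

  represents-Natrec : ∀ σ {f f' x x'} → (∀ n → Represents (σ ⇒ σ) (f n) (f' n)) → Represents σ x x'
                    → ∀ k → Represents σ (Natrec f x k) (Natrec f' x' k)
  represents-Natrec σ f≈f' x≈x' zero    = x≈x'
  represents-Natrec σ f≈f' x≈x' (suc k) = f≈f' k (represents-Natrec σ f≈f' x≈x' k)

  represents-extT : ∀ σ {Γ} (γ : Env Γ) {f f'} → (∀ n → Represents σ (f n) (f' n))
                  → ∀ {c d} → Represents ι c d → Represents σ (⟦ wk0 (extT σ A) ⟧ γ f c) (extB σ f' d)
  represents-extT ι         γ {f' = f'} f≈f' {d = d} c≈d = represents-K f' f≈f' d c≈d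
  represents-extT (σ₁ ⇒ σ₂) γ {f} f≈f' {c} c≈d {s} s≈s' =
    subst (λ T → Represents σ₂ (⟦ T ⟧ (((γ ∷ₑ f) ∷ₑ c) ∷ₑ s) (λ x → f x s) c) _)
      (sym (rename-wk0 (liftR (liftR (liftR (λ ())))) (extT σ₂ A)))
      (represents-extT σ₂ _ (λ n → f≈f' n s≈s') c≈d)

  EnvRepresents : ∀ {Γ Δ} → Ren (⌈ Γ ⌉ctx A) Δ → Env Δ → BEnv Γ → Set
  EnvRepresents {Γ} ρ γ δ = ∀ {τ} (x : Γ ∋ τ) → Represents τ (γ (ρ (⌈ x ⌉var A))) (δ x)

  EnvRepresents-∷ : ∀ {Γ Δ σ} {ρ : Ren (⌈ Γ ⌉ctx A) Δ} {γ : Env Δ} {δ : BEnv Γ}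
                  → EnvRepresents ρ γ δ
                  → ∀ {a a'} → Represents σ a a' → EnvRepresents (liftR ρ) (γ ∷ₑ a) (δ ∷ᵇ a')
  EnvRepresents-∷ γ≈δ a≈a' here      = a≈a'
  EnvRepresents-∷ γ≈δ a≈a' (there x) = γ≈δ x

  -- The translation contains weakened subterms, so the lemma is stated for all renamings
  -- of the translated term.
  fundamental : ∀ {Γ Δ σ} (t : Tm Γ σ) (ρ : Ren (⌈ Γ ⌉ctx A) Δ) (γ : Env Δ) (δ : BEnv Γ)
              → EnvRepresents ρ γ δ → Represents σ (⟦ rename ρ (⌈ t ⌉ A) ⟧ γ) (B⟦ t ⟧ δ)
  fundamental (var x)  ρ γ δ γ≈δ = γ≈δ x
  fundamental Zero     ρ γ δ γ≈δ = represents-η 0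
  fundamental (Succ t) ρ γ δ γ≈δ =
    represents-K (η ∘ suc) (represents-η ∘ suc) (B⟦ t ⟧ δ) (fundamental t ρ γ δ γ≈δ)
  fundamental (Rec {σ = σ} t p q) ρ γ δ γ≈δ rewrite rename-wk0 ρ (extT σ A) =
    represents-extT σ γ (λ m → represents-Natrec σ (step m) (base m) m) (fundamental q ρ γ δ γ≈δ)
    where
    step : ∀ m n → Represents (σ ⇒ σ)
      (⟦ rename (liftR (liftR ρ)) (wk (wk (⌈ t ⌉ A))) ⟧ ((γ ∷ₑ m) ∷ₑ n) (λ e b → e n)) (B⟦ t ⟧ δ (η n))
    step m n =
      subst (λ T → Represents (ι ⇒ σ ⇒ σ) (⟦ T ⟧ ((γ ∷ₑ m) ∷ₑ n)) (B⟦ t ⟧ δ))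
        (sym (trans (rename-∘ (liftR (liftR ρ)) there (wk (⌈ t ⌉ A))) (rename-∘ _ there (⌈ t ⌉ A))))
        (fundamental t _ _ δ γ≈δ) (represents-η n)
    base : ∀ m → Represents σ (⟦ rename (liftR ρ) (wk (⌈ p ⌉ A)) ⟧ (γ ∷ₑ m)) (B⟦ p ⟧ δ)
    base m =
      subst (λ T → Represents σ (⟦ T ⟧ (γ ∷ₑ m)) (B⟦ p ⟧ δ))
        (sym (rename-∘ (liftR ρ) there (⌈ p ⌉ A)))
        (fundamental p _ _ δ γ≈δ)
  fundamental (Lam t) ρ γ δ γ≈δ a≈a' = fundamental t (liftR ρ) _ _ (EnvRepresents-∷ γ≈δ a≈a')
  fundamental (t · u) ρ γ δ γ≈δ      = fundamental t ρ γ δ γ≈δ (fundamental u ρ γ δ γ≈δ)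

  represents-generic : Represents (ι ⇒ ι) (⟦ genericA A ⟧ emptyEnv) generic
  represents-generic {y = d} = represents-K (β η) (λ i e b-ext → refl) d

  represents-dialogueTree : (t : Tm ε ((ι ⇒ ι) ⇒ ι))
                          → Represents ι (⟦ dialogueTreeA A t ⟧ emptyEnv) (dialogueTree t)
  represents-dialogueTree t =
    subst (λ T → Represents ((ι ⇒ ι) ⇒ ι) (⟦ T ⟧ emptyEnv) (B⟦ t ⟧ emptyBEnv))
      (rename-id (⌈ t ⌉ A))
      (fundamental t id emptyEnv emptyBEnv (λ ()))
      (λ {_} {d} → represents-generic {y = d})

open Representation ι

lemma44 : (maxT : Tm ε (ι ⇒ ι ⇒ ι))
    → (∀ a b → ⟦ maxT ⟧ emptyEnv a b ≡ a ⊔ b)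
    → (t : Tm ε ((ι ⇒ ι) ⇒ ι)) (α : ℕ → ℕ)
    → ⟦ maxQT maxT · dialogueTreeA ι t ⟧ emptyEnv α ≡ maxQ (dialogueTree t) α
lemma44 maxT maxT≗⊔ t α =
  trans (represents-dialogueTree t (λ _ → 0) (maxQ-node-extensional α node≗))
        (foldD-maxQ α node≗ (dialogueTree t))
  where
  node≗ : ∀ g i → ⟦ wk0 maxT ⟧ _ i (g (α i)) ≡ i ⊔ g (α i)
  node≗ g i = trans (⟦wk0⟧ maxT _ refl refl) (maxT≗⊔ i (g (α i)))
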